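{- Let $G=(V_G,E_G)$ and $H=(V_H,E_H)$ be finite simple connected graphs with $|V_G|=n$ and $|V_H|=m$. Then $$M_1(G\wr H)=m^{n-1}\big(mM_1(G)+nM_1(H)+8|E_G||E_H|\big)$$ and $$M_2(G\wr H)=3m^{n-1}|E_H|M_1(G)+2|E_G|m^{n-1}M_1(H)+m^nM_2(G)+nm^{n-1}M_2(H)+4m^{n-2}|E_G||E_H|^2.$$
   Context: For a finite simple graph $G$, the first Zagreb index is $M_1(G)=\sum_{v\in V_G}(\deg v)^2$ and the second Zagreb index is $M_2(G)=\sum_{\{u,v\}\in E_G}\deg u\,\deg v$ (each edge counted once). The wreath product $G\wr H$ is the graph with vertex set $\{(f,v): f:V_G\to V_H,\ v\in V_G\}$, in which $(f,v)$ and $(f',v')$ are adjacent if and only if either $v=v'$, $f(w)=f'(w)$ for all $w\neq v$ and $f(v)\sim f'(v)$ in $H$; or $f=f'$ and $v\sim v'$ in $G$. -}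

module Defs where

open import Data.Nat using (ℕ; zero; suc; _+_; _*_; _^_; NonZero)
open import Data.Fin using (Fin; _≟_)
open import Data.List using (List; []; _∷_; map; filter; length; _++_; concatMap; allFin)
open import Data.Nat.ListAction using (sum)
open import Data.Bool.ListAction using (and)
open import Data.Bool using (Bool; true; false; _∧_; _∨_; not; T; if_then_else_)
open import Data.Product using (_×_; _,_; proj₁; proj₂)
open import Data.Vec.Functional using (Vector) renaming (_∷_ to _∷ᶠ_)
open import Relation.Nullary.Decidable using (⌊_⌋; does)
open import Relation.Binary.PropositionalEquality using (_≡_)

-- Generic invariants of a finite simple graph given by an exhaustive,
-- duplicate-free enumeration `vs` of its vertices and a Boolean
-- adjacency relation `adj`.

module _ {V : Set} (vs : List V) (adj : V → V → Bool) where

  deg : V → ℕ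
  deg v = length (filter (λ u → T? (adj v u)) vs)
    where
    open import Data.Bool.Properties using (T?)

  pairsAfter : List V → List (V × V)
  pairsAfter []       = []
  pairsAfter (x ∷ xs) = map (λ y → (x , y)) xs ++ pairsAfter xs

  edges : List (V × V)
  edges = filter (λ e → T? (adj (proj₁ e) (proj₂ e))) (pairsAfter vs)
    where
    open import Data.Bool.Properties using (T?)

  numEdges : ℕ
  numEdges = length edges

  M₁ : ℕ
  M₁ = sum (map (λ v → deg v * deg v) vs)

  M₂ : ℕ
  M₂ = sum (map (λ e → deg (proj₁ e) * deg (proj₂ e)) edges)

record SimpleGraph (n : ℕ) : Set where
  field
    adj   : Fin n → Fin n → Bool
    sym   : ∀ u v → adj u v ≡ adj v u
    irrefl : ∀ v → adj v v ≡ false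

open SimpleGraph public

data Reachable {n : ℕ} (G : SimpleGraph n) : Fin n → Fin n → Set where
  here : ∀ {v} → Reachable G v v
  step : ∀ {u w v} → T (adj G u w) → Reachable G w v → Reachable G u v

record Connected {n : ℕ} (G : SimpleGraph n) : Set where
  field
    nonempty : NonZero n
    reach    : ∀ u v → Reachable G u v

degG : ∀ {n} → SimpleGraph n → Fin n → ℕ
degG {n} G = deg (allFin n) (adj G)

|E| : ∀ {n} → SimpleGraph n → ℕ
|E| {n} G = numEdges (allFin n) (adj G)

M₁G : ∀ {n} → SimpleGraph n → ℕ
M₁G {n} G = M₁ (allFin n) (adj G)

M₂G : ∀ {n} → SimpleGraph n → ℕ
M₂G {n} G = M₂ (allFin n) (adj G)

allFuns : (n m : ℕ) → List (Fin n → Fin m)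
allFuns zero    m = (λ ()) ∷ []
allFuns (suc n) m = concatMap (λ a → map (λ f → a ∷ᶠ f) (allFuns n m)) (allFin m)

_=ᶠ_ : ∀ {k} → Fin k → Fin k → Bool
a =ᶠ b = does (a ≟ b)

WVertex : ℕ → ℕ → Set
WVertex n m = (Fin n → Fin m) × Fin n

wreathVertices : (n m : ℕ) → List (WVertex n m)
wreathVertices n m = concatMap (λ f → map (λ v → (f , v)) (allFin n)) (allFuns n m)

agreeOff : ∀ {n m} → Fin n → (Fin n → Fin m) → (Fin n → Fin m) → Bool
agreeOff {n} v f f' = and (map (λ w → (w =ᶠ v) ∨ (f w =ᶠ f' w)) (allFin n))

funEq : ∀ {n m} → (Fin n → Fin m) → (Fin n → Fin m) → Bool
funEq {n} f f' = and (map (λ w → f w =ᶠ f' w) (allFin n))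

wreathAdj : ∀ {n m} → SimpleGraph n → SimpleGraph m → WVertex n m → WVertex n m → Bool
wreathAdj G H (f , v) (f' , v') =
  ((v =ᶠ v') ∧ agreeOff v f f' ∧ adj H (f v) (f' v))
  ∨ (funEq f f' ∧ adj G v v')

M₁≀ : ∀ {n m} → SimpleGraph n → SimpleGraph m → ℕ
M₁≀ {n} {m} G H = M₁ (wreathVertices n m) (wreathAdj G H)

M₂≀ : ∀ {n m} → SimpleGraph n → SimpleGraph m → ℕ
M₂≀ {n} {m} G H = M₂ (wreathVertices n m) (wreathAdj G H)

module Submission where

-- The vertex (f, v) of G ≀ H is adjacent to the (f', v) with f' = f off v and f' v ~ f v in H,
-- and to the (f, v') with v' ~ v in G, so its degree is deg_H (f v) + deg_G v.  Both indices
-- are sums over the m ^ n functions f of quantities depending on f only through one value f v,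
-- or through two values f v, f v' with v ≠ v'; each value (pair of values) is attained by
-- m ^ (n - 1) (resp. m ^ (n - 2)) functions.  What remains are sums over G and H of quadratic
-- expressions in the degrees, evaluated by the handshake lemma together with
-- ∑_{x ~ y} deg x = M₁ and ∑_{x ~ y} deg x · deg y = 2 M₂.

open import Defs hiding (sym)
open import Data.Bool using (Bool; true; false; _∧_; _∨_)
open import Data.Bool.ListAction using (and)
open import Data.Bool.Properties using (T?; ∧-zeroʳ)
open import Data.Fin using (Fin; zero; suc; _≟_)
open import Data.List using (List; []; _∷_; _++_; map; filter; length; concatMap; allFin)
open import Data.List.Properties using (map-tabulate; map-cong; length-tabulate)
open import Data.Nat using (ℕ; zero; suc; _+_; _*_; _^_; _∸_)
open import Data.Nat.ListAction using (sum)
open import Data.Nat.Properties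
  using (+-assoc; +-identityʳ; *-identityʳ; *-zeroʳ; *-comm; *-assoc; *-distribˡ-+; *-cancelˡ-≡; *-commutativeSemigroup)
open import Data.Nat.Solver using (module +-*-Solver)
open import Algebra.Properties.CommutativeSemigroup *-commutativeSemigroup using (x∙yz≈y∙xz)
open import Data.Product using (_×_; _,_; proj₁; proj₂)
open import Data.Vec.Functional using () renaming (_∷_ to _∷ᶠ_)
open import Function using (_∘_)
open import Relation.Binary.PropositionalEquality
open import Relation.Nullary using (yes; no; contradiction)
open import Relation.Nullary.Decidable using (dec-true; dec-false)

open +-*-Solver using (solve; _:+_; _:*_; _:=_; con)
open ≡-Reasoning

-- Finite sums over lists

∑ : {A : Set} → List A → (A → ℕ) → ℕ
∑ xs f = sum (map f xs)

syntax ∑ xs (λ x → e) = ∑[ x ∈ xs ] e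

⟦_⟧ : Bool → ℕ
⟦ true ⟧  = 1
⟦ false ⟧ = 0

⟦∧⟧-* : ∀ a b x → ⟦ a ∧ b ⟧ * x ≡ ⟦ a ⟧ * (⟦ b ⟧ * x)
⟦∧⟧-* true  b x = sym (+-identityʳ (⟦ b ⟧ * x))
⟦∧⟧-* false b x = refl

⟦∨⟧-* : ∀ a b x → a ∧ b ≡ false → ⟦ a ∨ b ⟧ * x ≡ ⟦ a ⟧ * x + ⟦ b ⟧ * x
⟦∨⟧-* true  true  x ()
⟦∨⟧-* true  false x _ = sym (+-identityʳ (x + 0))
⟦∨⟧-* false b     x _ = refl

module _ {A : Set} where

  ∑-cong : (xs : List A) {f g : A → ℕ} → (∀ x → f x ≡ g x) → ∑ xs f ≡ ∑ xs g
  ∑-cong []       f≗g = refl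
  ∑-cong (x ∷ xs) f≗g = cong₂ _+_ (f≗g x) (∑-cong xs f≗g)

  ∑-zero : (xs : List A) → ∑[ x ∈ xs ] 0 ≡ 0
  ∑-zero []       = refl
  ∑-zero (x ∷ xs) = ∑-zero xs

  ∑-const : (xs : List A) (c : ℕ) → ∑[ x ∈ xs ] c ≡ length xs * c
  ∑-const []       c = refl
  ∑-const (x ∷ xs) c = cong (c +_) (∑-const xs c)

  ∑-+ : (xs : List A) (f g : A → ℕ) → ∑[ x ∈ xs ] (f x + g x) ≡ ∑ xs f + ∑ xs g
  ∑-+ []       f g = refl
  ∑-+ (x ∷ xs) f g = begin
    f x + g x + ∑[ x ∈ xs ] (f x + g x)  ≡⟨ cong (f x + g x +_) (∑-+ xs f g) ⟩
    f x + g x + (∑ xs f + ∑ xs g)        ≡⟨ solve 4 (λ a b c d → a :+ b :+ (c :+ d) := a :+ c :+ (b :+ d))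
                                                    refl (f x) (g x) (∑ xs f) (∑ xs g) ⟩
    f x + ∑ xs f + (g x + ∑ xs g)        ∎

  ∑-*ˡ : (xs : List A) (c : ℕ) (f : A → ℕ) → ∑[ x ∈ xs ] (c * f x) ≡ c * ∑ xs f
  ∑-*ˡ []       c f = sym (*-zeroʳ c)
  ∑-*ˡ (x ∷ xs) c f = trans (cong (c * f x +_) (∑-*ˡ xs c f)) (sym (*-distribˡ-+ c (f x) _))

  ∑-*ʳ : (xs : List A) (c : ℕ) (f : A → ℕ) → ∑[ x ∈ xs ] (f x * c) ≡ ∑ xs f * c
  ∑-*ʳ xs c f = begin
    ∑[ x ∈ xs ] (f x * c) ≡⟨ ∑-cong xs (λ x → *-comm (f x) c) ⟩
    ∑[ x ∈ xs ] (c * f x) ≡⟨ ∑-*ˡ xs c f ⟩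
    c * ∑ xs f            ≡⟨ *-comm c _ ⟩
    ∑ xs f * c            ∎

  ∑-linear₃ : (xs : List A) (a b c : ℕ) (f g h : A → ℕ) →
    ∑[ x ∈ xs ] (a * f x + b * g x + c * h x) ≡ a * ∑ xs f + b * ∑ xs g + c * ∑ xs h
  ∑-linear₃ xs a b c f g h =
    trans (∑-+ xs _ _) (cong₂ _+_ (trans (∑-+ xs _ _) (cong₂ _+_ (∑-*ˡ xs a f) (∑-*ˡ xs b g))) (∑-*ˡ xs c h))

  ∑-linear₄ : (xs : List A) (a b c d : ℕ) (f g h k : A → ℕ) →
    ∑[ x ∈ xs ] (a * f x + b * g x + c * h x + d * k x)
      ≡ a * ∑ xs f + b * ∑ xs g + c * ∑ xs h + d * ∑ xs k
  ∑-linear₄ xs a b c d f g h k = trans (∑-+ xs _ _) (cong₂ _+_ (∑-linear₃ xs a b c f g h) (∑-*ˡ xs d k))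

  ∑-++ : (xs ys : List A) (f : A → ℕ) → ∑ (xs ++ ys) f ≡ ∑ xs f + ∑ ys f
  ∑-++ []       ys f = refl
  ∑-++ (x ∷ xs) ys f = trans (cong (f x +_) (∑-++ xs ys f)) (sym (+-assoc (f x) _ _))

  ∑-map : {B : Set} (xs : List B) (g : B → A) (f : A → ℕ) → ∑ (map g xs) f ≡ ∑[ x ∈ xs ] f (g x)
  ∑-map []       g f = refl
  ∑-map (x ∷ xs) g f = cong (f (g x) +_) (∑-map xs g f)

  ∑-concatMap : {B : Set} (xs : List B) (g : B → List A) (f : A → ℕ) →
    ∑ (concatMap g xs) f ≡ ∑[ x ∈ xs ] ∑ (g x) f
  ∑-concatMap []       g f = refl
  ∑-concatMap (x ∷ xs) g f =
    trans (∑-++ (g x) (concatMap g xs) f) (cong (∑ (g x) f +_) (∑-concatMap xs g f))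

  ∑-filter : (xs : List A) (P : A → Bool) (f : A → ℕ) →
    ∑ (filter (T? ∘ P) xs) f ≡ ∑[ x ∈ xs ] (⟦ P x ⟧ * f x)
  ∑-filter []       P f = refl
  ∑-filter (x ∷ xs) P f with P x
  ... | true  = cong₂ _+_ (sym (+-identityʳ (f x))) (∑-filter xs P f)
  ... | false = ∑-filter xs P f

  length-filter : (xs : List A) (P : A → Bool) → length (filter (T? ∘ P) xs) ≡ ∑[ x ∈ xs ] ⟦ P x ⟧
  length-filter []       P = refl
  length-filter (x ∷ xs) P with P x
  ... | true  = cong suc (length-filter xs P)
  ... | false = length-filter xs P

∑-comm : {A B : Set} (xs : List A) (ys : List B) (f : A → B → ℕ) →
  ∑[ x ∈ xs ] ∑[ y ∈ ys ] f x y ≡ ∑[ y ∈ ys ] ∑[ x ∈ xs ] f x y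
∑-comm []       ys f = sym (∑-zero ys)
∑-comm (x ∷ xs) ys f = trans (cong (∑ ys (f x) +_) (∑-comm xs ys f)) (sym (∑-+ ys (f x) _))

∑∑-square : {A B : Set} (xs : List A) (ys : List B) (f : B → ℕ) (g : A → ℕ) →
  ∑[ x ∈ xs ] ∑[ y ∈ ys ] ((f y + g x) * (f y + g x))
    ≡ length xs * ∑[ y ∈ ys ] (f y * f y) + 2 * ∑ ys f * ∑ xs g + length ys * ∑[ x ∈ xs ] (g x * g x)
∑∑-square xs ys f g = begin
  ∑[ x ∈ xs ] ∑[ y ∈ ys ] ((f y + g x) * (f y + g x))
    ≡⟨ ∑-cong xs (λ x → trans (∑-cong ys (λ y → expand (f y) (g x)))
                               (∑-linear₃ ys 1 (2 * g x) (g x * g x) (λ y → f y * f y) f (λ _ → 1))) ⟩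
  ∑[ x ∈ xs ] (1 * F² + 2 * g x * F + g x * g x * ∑[ y ∈ ys ] 1)
    ≡⟨ ∑-cong xs (λ x → solve 4 (λ a b c l → con 1 :* a :+ con 2 :* c :* b :+ c :* c :* l
                                              := a :* con 1 :+ (con 2 :* b) :* c :+ l :* (c :* c))
                                 refl F² F (g x) (∑[ y ∈ ys ] 1)) ⟩
  ∑[ x ∈ xs ] (F² * 1 + 2 * F * g x + ∑[ y ∈ ys ] 1 * (g x * g x))
    ≡⟨ ∑-linear₃ xs F² (2 * F) (∑[ y ∈ ys ] 1) (λ _ → 1) g (λ x → g x * g x) ⟩
  F² * ∑[ x ∈ xs ] 1 + 2 * F * ∑ xs g + ∑[ y ∈ ys ] 1 * ∑[ x ∈ xs ] (g x * g x)
    ≡⟨ cong₂ (λ s t → F² * s + 2 * F * ∑ xs g + t * ∑[ x ∈ xs ] (g x * g x)) (∑-const xs 1) (∑-const ys 1) ⟩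
  F² * (length xs * 1) + 2 * F * ∑ xs g + length ys * 1 * ∑[ x ∈ xs ] (g x * g x)
    ≡⟨ solve 6 (λ a b c d e h → a :* (d :* con 1) :+ b :+ e :* con 1 :* h := d :* a :+ b :+ e :* h)
               refl F² (2 * F * ∑ xs g) F (length xs) (length ys) (∑[ x ∈ xs ] (g x * g x)) ⟩
  length xs * F² + 2 * F * ∑ xs g + length ys * ∑[ x ∈ xs ] (g x * g x) ∎
  where
  F² F : ℕ
  F² = ∑[ y ∈ ys ] (f y * f y)
  F = ∑ ys f
  expand : ∀ a b → (a + b) * (a + b) ≡ 1 * (a * a) + 2 * b * a + b * b * 1
  expand a b = solve 2 (λ a b → (a :+ b) :* (a :+ b) := con 1 :* (a :* a) :+ con 2 :* b :* a :+ b :* b :* con 1) refl a b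

map-allFin-suc : {A : Set} (k : ℕ) (f : Fin (suc k) → A) →
  map f (allFin (suc k)) ≡ f zero ∷ map (f ∘ suc) (allFin k)
map-allFin-suc k f = cong (f zero ∷_) (trans (map-tabulate suc f) (sym (map-tabulate (λ i → i) (f ∘ suc))))

∑-allFin-suc : (k : ℕ) (f : Fin (suc k) → ℕ) → ∑ (allFin (suc k)) f ≡ f zero + ∑ (allFin k) (f ∘ suc)
∑-allFin-suc k f = cong sum (map-allFin-suc k f)

∑-allFin-const : (k c : ℕ) → ∑[ i ∈ allFin k ] c ≡ k * c
∑-allFin-const k c = trans (∑-const (allFin k) c) (cong (_* c) (length-tabulate {n = k} (λ i → i)))

∑-δ : ∀ {k} (i : Fin k) (f : Fin k → ℕ) → ∑[ j ∈ allFin k ] (⟦ i =ᶠ j ⟧ * f j) ≡ f i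
∑-δ {suc k} zero f = begin
  ∑[ j ∈ allFin (suc k) ] (⟦ zero =ᶠ j ⟧ * f j) ≡⟨ ∑-allFin-suc k (λ j → ⟦ zero =ᶠ j ⟧ * f j) ⟩
  f zero + 0 + ∑[ j ∈ allFin k ] 0            ≡⟨ cong₂ _+_ (+-identityʳ (f zero)) (∑-zero (allFin k)) ⟩
  f zero + 0                                   ≡⟨ +-identityʳ (f zero) ⟩
  f zero                                       ∎
∑-δ {suc k} (suc i) f = trans (∑-allFin-suc k (λ j → ⟦ suc i =ᶠ j ⟧ * f j)) (∑-δ i (f ∘ suc))

∑-δ∧ : ∀ {k} {B : Set} (ys : List B) (i : Fin k) (P : B → Bool) (ψ : Fin k → B → ℕ) →
  ∑[ j ∈ allFin k ] ∑[ y ∈ ys ] (⟦ (i =ᶠ j) ∧ P y ⟧ * ψ j y) ≡ ∑[ y ∈ ys ] (⟦ P y ⟧ * ψ i y)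
∑-δ∧ {k} ys i P ψ = begin
  ∑[ j ∈ allFin k ] ∑[ y ∈ ys ] (⟦ (i =ᶠ j) ∧ P y ⟧ * ψ j y)
    ≡⟨ ∑-cong (allFin k) (λ j → trans (∑-cong ys (λ y → ⟦∧⟧-* (i =ᶠ j) (P y) (ψ j y)))
                                      (∑-*ˡ ys ⟦ i =ᶠ j ⟧ _)) ⟩
  ∑[ j ∈ allFin k ] (⟦ i =ᶠ j ⟧ * ∑[ y ∈ ys ] (⟦ P y ⟧ * ψ j y))
    ≡⟨ ∑-δ i (λ j → ∑[ y ∈ ys ] (⟦ P y ⟧ * ψ j y)) ⟩
  ∑[ y ∈ ys ] (⟦ P y ⟧ * ψ i y) ∎

-- Degree sums of a simple graph

∑-pairsAfter : {V : Set} (vs : List V) (adj : V → V → Bool) (xs : List V) (w : V → V → ℕ) →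
  (∀ x y → w x y ≡ w y x) →
  2 * ∑[ e ∈ pairsAfter vs adj xs ] w (proj₁ e) (proj₂ e) + ∑[ x ∈ xs ] w x x
    ≡ ∑[ x ∈ xs ] ∑[ y ∈ xs ] w x y
∑-pairsAfter vs adj []       w w-sym = refl
∑-pairsAfter {V} vs adj (x ∷ xs) w w-sym = begin
  2 * ∑ (map (x ,_) xs ++ pairsAfter vs adj xs) w′ + (w x x + D)
    ≡⟨ cong (λ t → 2 * t + (w x x + D)) (trans (∑-++ (map (x ,_) xs) _ w′) (cong (_+ P) (∑-map xs (x ,_) w′))) ⟩
  2 * (R + P) + (w x x + D)
    ≡⟨ solve 4 (λ r p c d → con 2 :* (r :+ p) :+ (c :+ d) := c :+ r :+ (r :+ (con 2 :* p :+ d))) refl R P (w x x) D ⟩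
  w x x + R + (R + (2 * P + D))
    ≡⟨ cong₂ (λ s t → w x x + R + (s + t)) (∑-cong xs (w-sym x)) (∑-pairsAfter vs adj xs w w-sym) ⟩
  w x x + R + (∑[ y ∈ xs ] w y x + ∑[ y ∈ xs ] ∑[ z ∈ xs ] w y z)
    ≡⟨ cong (w x x + R +_) (sym (∑-+ xs (λ y → w y x) (λ y → ∑ xs (w y)))) ⟩
  w x x + R + ∑[ y ∈ xs ] (w y x + ∑[ z ∈ xs ] w y z) ∎
  where
  w′ : V × V → ℕ
  w′ e = w (proj₁ e) (proj₂ e)
  R P D : ℕ
  R = ∑ xs (w x)
  P = ∑ (pairsAfter vs adj xs) w′
  D = ∑[ y ∈ xs ] w y y

module GraphInvariants {V : Set} (vs : List V) (adj : V → V → Bool)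
  (adj-sym : ∀ x y → adj x y ≡ adj y x) (adj-irrefl : ∀ x → adj x x ≡ false) where

  private
    d : V → ℕ
    d = deg vs adj

  deg≡∑ : ∀ v → deg vs adj v ≡ ∑[ u ∈ vs ] ⟦ adj v u ⟧
  deg≡∑ v = length-filter vs (adj v)

  ∑-edges : (w : V → V → ℕ) → (∀ x y → w x y ≡ w y x) →
    2 * ∑[ e ∈ edges vs adj ] w (proj₁ e) (proj₂ e) ≡ ∑[ x ∈ vs ] ∑[ y ∈ vs ] (⟦ adj x y ⟧ * w x y)
  ∑-edges w w-sym = begin
    2 * ∑[ e ∈ edges vs adj ] w (proj₁ e) (proj₂ e)
      ≡⟨ cong (2 *_) (∑-filter (pairsAfter vs adj vs) _ _) ⟩
    2 * P                                                   ≡⟨ sym (+-identityʳ _) ⟩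
    2 * P + 0                                               ≡⟨ cong (2 * P +_) (sym loops-vanish) ⟩
    2 * P + ∑[ x ∈ vs ] (⟦ adj x x ⟧ * w x x)
      ≡⟨ ∑-pairsAfter vs adj vs (λ x y → ⟦ adj x y ⟧ * w x y) (λ x y → cong₂ _*_ (cong ⟦_⟧ (adj-sym x y)) (w-sym x y)) ⟩
    ∑[ x ∈ vs ] ∑[ y ∈ vs ] (⟦ adj x y ⟧ * w x y)           ∎
    where
    P : ℕ
    P = ∑[ e ∈ pairsAfter vs adj vs ] (⟦ adj (proj₁ e) (proj₂ e) ⟧ * w (proj₁ e) (proj₂ e))
    loops-vanish : ∑[ x ∈ vs ] (⟦ adj x x ⟧ * w x x) ≡ 0
    loops-vanish = trans (∑-cong vs (λ x → cong (λ b → ⟦ b ⟧ * w x x) (adj-irrefl x))) (∑-zero vs)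

  handshake : ∑[ x ∈ vs ] ∑[ y ∈ vs ] ⟦ adj x y ⟧ ≡ 2 * numEdges vs adj
  handshake = begin
    ∑[ x ∈ vs ] ∑[ y ∈ vs ] ⟦ adj x y ⟧         ≡⟨ ∑-cong vs (λ x → ∑-cong vs (λ y → sym (*-identityʳ ⟦ adj x y ⟧))) ⟩
    ∑[ x ∈ vs ] ∑[ y ∈ vs ] (⟦ adj x y ⟧ * 1)   ≡⟨ sym (∑-edges (λ _ _ → 1) (λ _ _ → refl)) ⟩
    2 * ∑[ e ∈ edges vs adj ] 1                 ≡⟨ cong (2 *_) (trans (∑-const (edges vs adj) 1) (*-identityʳ (numEdges vs adj))) ⟩
    2 * numEdges vs adj                         ∎

  ∑-deg : ∑ vs d ≡ 2 * numEdges vs adj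
  ∑-deg = trans (∑-cong vs deg≡∑) handshake

  ∑-adj-degˡ : ∑[ x ∈ vs ] ∑[ y ∈ vs ] (⟦ adj x y ⟧ * d x) ≡ M₁ vs adj
  ∑-adj-degˡ = ∑-cong vs (λ x → trans (∑-*ʳ vs (d x) (λ y → ⟦ adj x y ⟧)) (cong (_* d x) (sym (deg≡∑ x))))

  ∑-adj-degʳ : ∑[ x ∈ vs ] ∑[ y ∈ vs ] (⟦ adj x y ⟧ * d y) ≡ M₁ vs adj
  ∑-adj-degʳ = begin
    ∑[ x ∈ vs ] ∑[ y ∈ vs ] (⟦ adj x y ⟧ * d y) ≡⟨ ∑-comm vs vs (λ x y → ⟦ adj x y ⟧ * d y) ⟩
    ∑[ y ∈ vs ] ∑[ x ∈ vs ] (⟦ adj x y ⟧ * d y) ≡⟨ ∑-cong vs (λ y → ∑-cong vs (λ x → cong (λ b → ⟦ b ⟧ * d y) (adj-sym x y))) ⟩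
    ∑[ y ∈ vs ] ∑[ x ∈ vs ] (⟦ adj y x ⟧ * d y) ≡⟨ ∑-adj-degˡ ⟩
    M₁ vs adj                                   ∎

  ∑-adj-quadratic : (α β γ : ℕ) →
    ∑[ x ∈ vs ] ∑[ y ∈ vs ] (⟦ adj x y ⟧ * (α + β * (d x + d y) + γ * (d x * d y)))
      ≡ 2 * (α * numEdges vs adj + β * M₁ vs adj + γ * M₂ vs adj)
  ∑-adj-quadratic α β γ = begin
    ∑[ x ∈ vs ] ∑[ y ∈ vs ] (⟦ adj x y ⟧ * (α + β * (d x + d y) + γ * (d x * d y)))
      ≡⟨ ∑-cong vs (λ x → trans (∑-cong vs (λ y → expand ⟦ adj x y ⟧ (d x) (d y))) (∑-linear₄ vs α β β γ _ _ _ _)) ⟩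
    ∑[ x ∈ vs ] (α * ∑[ y ∈ vs ] ⟦ adj x y ⟧ + β * ∑[ y ∈ vs ] (⟦ adj x y ⟧ * d x)
                 + β * ∑[ y ∈ vs ] (⟦ adj x y ⟧ * d y) + γ * ∑[ y ∈ vs ] (⟦ adj x y ⟧ * (d x * d y)))
      ≡⟨ ∑-linear₄ vs α β β γ _ _ _ _ ⟩
    α * ∑[ x ∈ vs ] ∑[ y ∈ vs ] ⟦ adj x y ⟧ + β * ∑[ x ∈ vs ] ∑[ y ∈ vs ] (⟦ adj x y ⟧ * d x)
      + β * ∑[ x ∈ vs ] ∑[ y ∈ vs ] (⟦ adj x y ⟧ * d y) + γ * ∑[ x ∈ vs ] ∑[ y ∈ vs ] (⟦ adj x y ⟧ * (d x * d y))
      ≡⟨ cong₂ _+_ (cong₂ _+_ (cong₂ _+_ (cong (α *_) handshake) (cong (β *_) ∑-adj-degˡ)) (cong (β *_) ∑-adj-degʳ))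
                   (cong (γ *_) (sym (∑-edges (λ x y → d x * d y) (λ x y → *-comm (d x) (d y))))) ⟩
    α * (2 * numEdges vs adj) + β * M₁ vs adj + β * M₁ vs adj + γ * (2 * M₂ vs adj)
      ≡⟨ solve 6 (λ a b c e m₁ m₂ → a :* (con 2 :* e) :+ b :* m₁ :+ b :* m₁ :+ c :* (con 2 :* m₂)
                                    := con 2 :* (a :* e :+ b :* m₁ :+ c :* m₂))
               refl α β γ (numEdges vs adj) (M₁ vs adj) (M₂ vs adj) ⟩
    2 * (α * numEdges vs adj + β * M₁ vs adj + γ * M₂ vs adj) ∎
    where
    expand : ∀ i a b → i * (α + β * (a + b) + γ * (a * b)) ≡ α * i + β * (i * a) + β * (i * b) + γ * (i * (a * b))
    expand i a b = solve 6 (λ i a b α β γ → i :* (α :+ β :* (a :+ b) :+ γ :* (a :* b))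
                                          := α :* i :+ β :* (i :* a) :+ β :* (i :* b) :+ γ :* (i :* (a :* b)))
                           refl i a b α β γ

-- Sums over the functions Fin k → Fin m

module _ {m : ℕ} where

  ∑-allFuns-suc : (k : ℕ) (φ : (Fin (suc k) → Fin m) → ℕ) →
    ∑ (allFuns (suc k) m) φ ≡ ∑[ a ∈ allFin m ] ∑[ g ∈ allFuns k m ] φ (a ∷ᶠ g)
  ∑-allFuns-suc k φ =
    trans (∑-concatMap (allFin m) _ φ) (∑-cong (allFin m) (λ a → ∑-map (allFuns k m) (a ∷ᶠ_) φ))

  ∑-allFuns-const : (k c : ℕ) → ∑[ f ∈ allFuns k m ] c ≡ m ^ k * c
  ∑-allFuns-const zero    c = refl
  ∑-allFuns-const (suc k) c = begin
    ∑[ f ∈ allFuns (suc k) m ] c               ≡⟨ ∑-allFuns-suc k (λ _ → c) ⟩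
    ∑[ a ∈ allFin m ] ∑[ g ∈ allFuns k m ] c   ≡⟨ ∑-cong (allFin m) (λ _ → ∑-allFuns-const k c) ⟩
    ∑[ a ∈ allFin m ] (m ^ k * c)              ≡⟨ ∑-allFin-const m _ ⟩
    m * (m ^ k * c)                            ≡⟨ sym (*-assoc m _ c) ⟩
    m ^ suc k * c                              ∎

  ∑-allFuns-eval : ∀ {k} (v : Fin k) (h : Fin m → ℕ) →
    ∑[ f ∈ allFuns k m ] h (f v) ≡ m ^ (k ∸ 1) * ∑ (allFin m) h
  ∑-allFuns-eval {suc k} zero h = begin
    ∑[ f ∈ allFuns (suc k) m ] h (f zero)        ≡⟨ ∑-allFuns-suc k _ ⟩
    ∑[ a ∈ allFin m ] ∑[ g ∈ allFuns k m ] h a   ≡⟨ ∑-cong (allFin m) (λ a → ∑-allFuns-const k (h a)) ⟩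
    ∑[ a ∈ allFin m ] (m ^ k * h a)              ≡⟨ ∑-*ˡ (allFin m) (m ^ k) h ⟩
    m ^ k * ∑ (allFin m) h                       ∎
  ∑-allFuns-eval {suc (suc k)} (suc v) h = begin
    ∑[ f ∈ allFuns (suc (suc k)) m ] h (f (suc v))      ≡⟨ ∑-allFuns-suc (suc k) _ ⟩
    ∑[ a ∈ allFin m ] ∑[ g ∈ allFuns (suc k) m ] h (g v) ≡⟨ ∑-cong (allFin m) (λ _ → ∑-allFuns-eval v h) ⟩
    ∑[ a ∈ allFin m ] (m ^ k * ∑ (allFin m) h)          ≡⟨ ∑-allFin-const m _ ⟩
    m * (m ^ k * ∑ (allFin m) h)                        ≡⟨ sym (*-assoc m _ _) ⟩
    m ^ suc k * ∑ (allFin m) h                          ∎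

  ∑-allFuns-eval₂ : ∀ {k} {u v : Fin k} → u ≢ v → (h q : Fin m → ℕ) →
    ∑[ f ∈ allFuns k m ] (h (f u) * q (f v)) ≡ m ^ (k ∸ 2) * (∑ (allFin m) h * ∑ (allFin m) q)
  ∑-allFuns-eval₂ {u = zero} {zero} u≢v h q = contradiction refl u≢v
  ∑-allFuns-eval₂ {suc k} {zero} {suc v} u≢v h q = begin
    ∑[ f ∈ allFuns (suc k) m ] (h (f zero) * q (f (suc v)))    ≡⟨ ∑-allFuns-suc k _ ⟩
    ∑[ a ∈ allFin m ] ∑[ g ∈ allFuns k m ] (h a * q (g v))
      ≡⟨ ∑-cong (allFin m) (λ a → trans (∑-*ˡ (allFuns k m) (h a) _) (cong (h a *_) (∑-allFuns-eval v q))) ⟩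
    ∑[ a ∈ allFin m ] (h a * (m ^ (k ∸ 1) * ∑q))              ≡⟨ ∑-*ʳ (allFin m) _ h ⟩
    ∑h * (m ^ (k ∸ 1) * ∑q)
      ≡⟨ x∙yz≈y∙xz ∑h (m ^ (k ∸ 1)) ∑q ⟩
    m ^ (k ∸ 1) * (∑h * ∑q)                                    ∎
    where
    ∑h ∑q : ℕ
    ∑h = ∑ (allFin m) h
    ∑q = ∑ (allFin m) q
  ∑-allFuns-eval₂ {suc k} {suc u} {zero} u≢v h q = begin
    ∑[ f ∈ allFuns (suc k) m ] (h (f (suc u)) * q (f zero))    ≡⟨ ∑-allFuns-suc k _ ⟩
    ∑[ a ∈ allFin m ] ∑[ g ∈ allFuns k m ] (h (g u) * q a)
      ≡⟨ ∑-cong (allFin m) (λ a → trans (∑-*ʳ (allFuns k m) (q a) _) (cong (_* q a) (∑-allFuns-eval u h))) ⟩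
    ∑[ a ∈ allFin m ] (m ^ (k ∸ 1) * ∑h * q a)              ≡⟨ ∑-*ˡ (allFin m) (m ^ (k ∸ 1) * ∑h) q ⟩
    m ^ (k ∸ 1) * ∑h * ∑q                                    ≡⟨ *-assoc (m ^ (k ∸ 1)) ∑h ∑q ⟩
    m ^ (k ∸ 1) * (∑h * ∑q)                                  ∎
    where
    ∑h ∑q : ℕ
    ∑h = ∑ (allFin m) h
    ∑q = ∑ (allFin m) q
  -- Split off because the recursive case would need m * m ^ (0 ∸ 1) ≡ m ^ 0, false for m ≠ 1.
  ∑-allFuns-eval₂ {suc (suc zero)} {suc zero} {suc zero} u≢v h q = contradiction refl u≢v
  ∑-allFuns-eval₂ {suc (suc (suc k))} {suc u} {suc v} u≢v h q = begin
    ∑[ f ∈ allFuns (suc (suc (suc k))) m ] (h (f (suc u)) * q (f (suc v)))    ≡⟨ ∑-allFuns-suc (suc (suc k)) _ ⟩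
    ∑[ a ∈ allFin m ] ∑[ g ∈ allFuns (suc (suc k)) m ] (h (g u) * q (g v))
      ≡⟨ ∑-cong (allFin m) (λ _ → ∑-allFuns-eval₂ (u≢v ∘ cong suc) h q) ⟩
    ∑[ a ∈ allFin m ] (m ^ k * (∑h * ∑q))                                     ≡⟨ ∑-allFin-const m _ ⟩
    m * (m ^ k * (∑h * ∑q))                                                   ≡⟨ sym (*-assoc m _ _) ⟩
    m ^ suc k * (∑h * ∑q)                                                     ∎
    where
    ∑h ∑q : ℕ
    ∑h = ∑ (allFin m) h
    ∑q = ∑ (allFin m) q

  funEq-suc : ∀ {k} (f f' : Fin (suc k) → Fin m) →
    funEq f f' ≡ (f zero =ᶠ f' zero) ∧ funEq (f ∘ suc) (f' ∘ suc)
  funEq-suc {k} f f' = cong and (map-allFin-suc k (λ w → f w =ᶠ f' w))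

  agreeOff-zero : ∀ {k} (f f' : Fin (suc k) → Fin m) → agreeOff zero f f' ≡ funEq (f ∘ suc) (f' ∘ suc)
  agreeOff-zero {k} f f' = cong and (map-allFin-suc k (λ w → (w =ᶠ zero) ∨ (f w =ᶠ f' w)))

  agreeOff-suc : ∀ {k} (v : Fin k) (f f' : Fin (suc k) → Fin m) →
    agreeOff (suc v) f f' ≡ (f zero =ᶠ f' zero) ∧ agreeOff v (f ∘ suc) (f' ∘ suc)
  agreeOff-suc {k} v f f' = cong and (map-allFin-suc k (λ w → (w =ᶠ suc v) ∨ (f w =ᶠ f' w)))

  ∑-allFuns-funEq : ∀ {k} (f : Fin k → Fin m) (φ : (Fin k → Fin m) → ℕ) →
    (∀ {g g'} → (∀ w → g w ≡ g' w) → φ g ≡ φ g') →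
    ∑[ f' ∈ allFuns k m ] (⟦ funEq f f' ⟧ * φ f') ≡ φ f
  ∑-allFuns-funEq {zero} f φ φ-ext = trans (+-identityʳ _) (trans (+-identityʳ _) (φ-ext (λ ())))
  ∑-allFuns-funEq {suc k} f φ φ-ext = begin
    ∑[ f' ∈ allFuns (suc k) m ] (⟦ funEq f f' ⟧ * φ f')                          ≡⟨ ∑-allFuns-suc k _ ⟩
    ∑[ a ∈ allFin m ] ∑[ g ∈ allFuns k m ] (⟦ funEq f (a ∷ᶠ g) ⟧ * φ (a ∷ᶠ g))
      ≡⟨ ∑-cong (allFin m) (λ a → ∑-cong (allFuns k m) (λ g →
           cong (λ b → ⟦ b ⟧ * φ (a ∷ᶠ g)) (funEq-suc f (a ∷ᶠ g)))) ⟩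
    ∑[ a ∈ allFin m ] ∑[ g ∈ allFuns k m ] (⟦ (f zero =ᶠ a) ∧ funEq (f ∘ suc) g ⟧ * φ (a ∷ᶠ g))
      ≡⟨ ∑-δ∧ (allFuns k m) (f zero) (funEq (f ∘ suc)) (λ a g → φ (a ∷ᶠ g)) ⟩
    ∑[ g ∈ allFuns k m ] (⟦ funEq (f ∘ suc) g ⟧ * φ (f zero ∷ᶠ g))
      ≡⟨ ∑-allFuns-funEq (f ∘ suc) (λ g → φ (f zero ∷ᶠ g)) (λ g≗g' → φ-ext (λ { zero → refl ; (suc w) → g≗g' w })) ⟩
    φ (f zero ∷ᶠ (f ∘ suc))                                                       ≡⟨ φ-ext (λ { zero → refl ; (suc w) → refl }) ⟩
    φ f                                                                           ∎

  ∑-allFuns-agreeOff : ∀ {k} (v : Fin k) (f : Fin k → Fin m) (φ : Fin m → ℕ) →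
    ∑[ f' ∈ allFuns k m ] (⟦ agreeOff v f f' ⟧ * φ (f' v)) ≡ ∑ (allFin m) φ
  ∑-allFuns-agreeOff {suc k} zero f φ = begin
    ∑[ f' ∈ allFuns (suc k) m ] (⟦ agreeOff zero f f' ⟧ * φ (f' zero))            ≡⟨ ∑-allFuns-suc k _ ⟩
    ∑[ a ∈ allFin m ] ∑[ g ∈ allFuns k m ] (⟦ agreeOff zero f (a ∷ᶠ g) ⟧ * φ a)
      ≡⟨ ∑-cong (allFin m) (λ a → trans
           (∑-cong (allFuns k m) (λ g → cong (λ b → ⟦ b ⟧ * φ a) (agreeOff-zero f (a ∷ᶠ g))))
           (∑-allFuns-funEq (f ∘ suc) (λ _ → φ a) (λ _ → refl))) ⟩
    ∑ (allFin m) φ                                                                 ∎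
  ∑-allFuns-agreeOff {suc k} (suc v) f φ = begin
    ∑[ f' ∈ allFuns (suc k) m ] (⟦ agreeOff (suc v) f f' ⟧ * φ (f' (suc v)))      ≡⟨ ∑-allFuns-suc k _ ⟩
    ∑[ a ∈ allFin m ] ∑[ g ∈ allFuns k m ] (⟦ agreeOff (suc v) f (a ∷ᶠ g) ⟧ * φ (g v))
      ≡⟨ ∑-cong (allFin m) (λ a → ∑-cong (allFuns k m) (λ g → cong (λ b → ⟦ b ⟧ * φ (g v)) (agreeOff-suc v f (a ∷ᶠ g)))) ⟩
    ∑[ a ∈ allFin m ] ∑[ g ∈ allFuns k m ] (⟦ (f zero =ᶠ a) ∧ agreeOff v (f ∘ suc) g ⟧ * φ (g v))
      ≡⟨ ∑-δ∧ (allFuns k m) (f zero) (agreeOff v (f ∘ suc)) (λ _ g → φ (g v)) ⟩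
    ∑[ g ∈ allFuns k m ] (⟦ agreeOff v (f ∘ suc) g ⟧ * φ (g v))                   ≡⟨ ∑-allFuns-agreeOff v (f ∘ suc) φ ⟩
    ∑ (allFin m) φ                                                                 ∎

  ∑-allFuns-affineProduct : ∀ {k} {u v : Fin k} → u ≢ v → (h : Fin m → ℕ) (c c′ : ℕ) →
    ∑[ f ∈ allFuns k m ] ((h (f u) + c) * (h (f v) + c′))
      ≡ m ^ (k ∸ 2) * (∑ (allFin m) h * ∑ (allFin m) h) + m ^ (k ∸ 1) * ∑ (allFin m) h * (c + c′) + m ^ k * (c * c′)
  ∑-allFuns-affineProduct {k} {u} {v} u≢v h c c′ = begin
    ∑[ f ∈ allFuns k m ] ((h (f u) + c) * (h (f v) + c′))
      ≡⟨ ∑-cong (allFuns k m) (λ f → expand (h (f u)) (h (f v))) ⟩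
    ∑[ f ∈ allFuns k m ] (1 * (h (f u) * h (f v)) + c′ * h (f u) + c * h (f v) + (c * c′) * 1)
      ≡⟨ ∑-linear₄ (allFuns k m) 1 c′ c (c * c′) _ _ _ _ ⟩
    1 * ∑[ f ∈ allFuns k m ] (h (f u) * h (f v)) + c′ * ∑[ f ∈ allFuns k m ] h (f u)
      + c * ∑[ f ∈ allFuns k m ] h (f v) + (c * c′) * ∑[ f ∈ allFuns k m ] 1
      ≡⟨ cong₂ _+_ (cong₂ _+_ (cong₂ _+_ (cong (1 *_) (∑-allFuns-eval₂ u≢v h h))
                                         (cong (c′ *_) (∑-allFuns-eval u h)))
                              (cong (c *_) (∑-allFuns-eval v h)))
                   (cong ((c * c′) *_) (∑-allFuns-const k 1)) ⟩
    1 * (m ^ (k ∸ 2) * (S * S)) + c′ * (m ^ (k ∸ 1) * S) + c * (m ^ (k ∸ 1) * S) + (c * c′) * (m ^ k * 1)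
      ≡⟨ solve 6 (λ p q r s c c′ → con 1 :* (p :* (s :* s)) :+ c′ :* (q :* s) :+ c :* (q :* s) :+ (c :* c′) :* (r :* con 1)
                                   := p :* (s :* s) :+ q :* s :* (c :+ c′) :+ r :* (c :* c′))
               refl (m ^ (k ∸ 2)) (m ^ (k ∸ 1)) (m ^ k) S c c′ ⟩
    m ^ (k ∸ 2) * (S * S) + m ^ (k ∸ 1) * S * (c + c′) + m ^ k * (c * c′) ∎
    where
    S : ℕ
    S = ∑ (allFin m) h
    expand : ∀ a b → (a + c) * (b + c′) ≡ 1 * (a * b) + c′ * a + c * b + (c * c′) * 1
    expand a b = solve 4 (λ a b c c′ → (a :+ c) :* (b :+ c′) := con 1 :* (a :* b) :+ c′ :* a :+ c :* b :+ (c :* c′) :* con 1)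
                         refl a b c c′

  ∑-allFuns-evalAt : ∀ {k} (F : Fin m → Fin k → ℕ) →
    ∑[ f ∈ allFuns k m ] ∑[ v ∈ allFin k ] F (f v) v ≡ m ^ (k ∸ 1) * ∑[ v ∈ allFin k ] ∑[ a ∈ allFin m ] F a v
  ∑-allFuns-evalAt {k} F = begin
    ∑[ f ∈ allFuns k m ] ∑[ v ∈ allFin k ] F (f v) v     ≡⟨ ∑-comm (allFuns k m) (allFin k) _ ⟩
    ∑[ v ∈ allFin k ] ∑[ f ∈ allFuns k m ] F (f v) v     ≡⟨ ∑-cong (allFin k) (λ v → ∑-allFuns-eval v (λ a → F a v)) ⟩
    ∑[ v ∈ allFin k ] (m ^ (k ∸ 1) * ∑[ a ∈ allFin m ] F a v) ≡⟨ ∑-*ˡ (allFin k) (m ^ (k ∸ 1)) _ ⟩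
    m ^ (k ∸ 1) * ∑[ v ∈ allFin k ] ∑[ a ∈ allFin m ] F a v   ∎

-- The wreath product

=ᶠ-sym : ∀ {k} (a b : Fin k) → (a =ᶠ b) ≡ (b =ᶠ a)
=ᶠ-sym a b with a ≟ b
... | yes refl = sym (dec-true (a ≟ a) refl)
... | no a≢b   = sym (dec-false (b ≟ a) (a≢b ∘ sym))

module Wreath {n m : ℕ} (G : SimpleGraph n) (H : SimpleGraph m) where

  funEq-sym : (f f' : Fin n → Fin m) → funEq f f' ≡ funEq f' f
  funEq-sym f f' = cong and (map-cong (λ w → =ᶠ-sym (f w) (f' w)) (allFin n))

  agreeOff-sym : ∀ v (f f' : Fin n → Fin m) → agreeOff v f f' ≡ agreeOff v f' f
  agreeOff-sym v f f' = cong and (map-cong (λ w → cong ((w =ᶠ v) ∨_) (=ᶠ-sym (f w) (f' w))) (allFin n))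

  wreathAdj-sym : ∀ x y → wreathAdj G H x y ≡ wreathAdj G H y x
  wreathAdj-sym (f , v) (f' , v') with v ≟ v' | v' ≟ v
  ... | yes refl | yes _ = cong₂ _∨_ (cong₂ _∧_ (agreeOff-sym v f f') (SimpleGraph.sym H (f v) (f' v)))
                                     (cong (_∧ adj G v v) (funEq-sym f f'))
  ... | no _     | no _  = cong₂ _∧_ (funEq-sym f f') (SimpleGraph.sym G v v')
  ... | yes refl | no ¬p = contradiction refl ¬p
  ... | no ¬p    | yes refl = contradiction refl ¬p

  wreathAdj-irrefl : ∀ x → wreathAdj G H x x ≡ false
  wreathAdj-irrefl (f , v) rewrite irrefl H (f v) | irrefl G v
    | ∧-zeroʳ (agreeOff v f f) | ∧-zeroʳ (v =ᶠ v) | ∧-zeroʳ (funEq f f) = refl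

  edgeKinds-disjoint : ∀ f v f' v' →
    ((v =ᶠ v') ∧ agreeOff v f f' ∧ adj H (f v) (f' v)) ∧ (funEq f f' ∧ adj G v v') ≡ false
  edgeKinds-disjoint f v f' v' with v ≟ v'
  ... | yes refl rewrite irrefl G v =
    trans (cong ((agreeOff v f f' ∧ adj H (f v) (f' v)) ∧_) (∧-zeroʳ (funEq f f'))) (∧-zeroʳ _)
  ... | no _     = refl

  ∑-wreathVertices : (φ : WVertex n m → ℕ) →
    ∑ (wreathVertices n m) φ ≡ ∑[ f ∈ allFuns n m ] ∑[ v ∈ allFin n ] φ (f , v)
  ∑-wreathVertices φ =
    trans (∑-concatMap (allFuns n m) _ φ) (∑-cong (allFuns n m) (λ f → ∑-map (allFin n) (f ,_) φ))

  ∑-neighbours : ∀ f v (κ : Fin m → Fin n → ℕ) →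
    ∑[ y ∈ wreathVertices n m ] (⟦ wreathAdj G H (f , v) y ⟧ * κ (proj₁ y (proj₂ y)) (proj₂ y))
      ≡ ∑[ b ∈ allFin m ] (⟦ adj H (f v) b ⟧ * κ b v) + ∑[ v' ∈ allFin n ] (⟦ adj G v v' ⟧ * κ (f v') v')
  ∑-neighbours f v κ = begin
    ∑[ y ∈ wreathVertices n m ] (⟦ wreathAdj G H (f , v) y ⟧ * κ (proj₁ y (proj₂ y)) (proj₂ y))
      ≡⟨ ∑-wreathVertices _ ⟩
    ∑[ f' ∈ allFuns n m ] ∑[ v' ∈ allFin n ] (⟦ wreathAdj G H (f , v) (f' , v') ⟧ * κ (f' v') v')
      ≡⟨ ∑-cong (allFuns n m) (λ f' → ∑-cong (allFin n) (λ v' →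
           ⟦∨⟧-* ((v =ᶠ v') ∧ inH f') (inG f' v') (κ (f' v') v') (edgeKinds-disjoint f v f' v'))) ⟩
    ∑[ f' ∈ allFuns n m ] ∑[ v' ∈ allFin n ] (⟦ (v =ᶠ v') ∧ inH f' ⟧ * κ (f' v') v' + ⟦ inG f' v' ⟧ * κ (f' v') v')
      ≡⟨ trans (∑-cong (allFuns n m) (λ f' → ∑-+ (allFin n) _ _)) (∑-+ (allFuns n m) _ _) ⟩
    ∑[ f' ∈ allFuns n m ] ∑[ v' ∈ allFin n ] (⟦ (v =ᶠ v') ∧ inH f' ⟧ * κ (f' v') v')
      + ∑[ f' ∈ allFuns n m ] ∑[ v' ∈ allFin n ] (⟦ inG f' v' ⟧ * κ (f' v') v')
      ≡⟨ cong₂ _+_ H-neighbours G-neighbours ⟩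
    ∑[ b ∈ allFin m ] (⟦ adj H (f v) b ⟧ * κ b v) + ∑[ v' ∈ allFin n ] (⟦ adj G v v' ⟧ * κ (f v') v') ∎
    where
    inH : (Fin n → Fin m) → Bool
    inH f' = agreeOff v f f' ∧ adj H (f v) (f' v)
    inG : (Fin n → Fin m) → Fin n → Bool
    inG f' v' = funEq f f' ∧ adj G v v'

    H-neighbours : ∑[ f' ∈ allFuns n m ] ∑[ v' ∈ allFin n ] (⟦ (v =ᶠ v') ∧ inH f' ⟧ * κ (f' v') v')
                     ≡ ∑[ b ∈ allFin m ] (⟦ adj H (f v) b ⟧ * κ b v)
    H-neighbours = begin
      ∑[ f' ∈ allFuns n m ] ∑[ v' ∈ allFin n ] (⟦ (v =ᶠ v') ∧ inH f' ⟧ * κ (f' v') v')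
        ≡⟨ ∑-comm (allFuns n m) (allFin n) _ ⟩
      ∑[ v' ∈ allFin n ] ∑[ f' ∈ allFuns n m ] (⟦ (v =ᶠ v') ∧ inH f' ⟧ * κ (f' v') v')
        ≡⟨ ∑-δ∧ (allFuns n m) v inH (λ v' f' → κ (f' v') v') ⟩
      ∑[ f' ∈ allFuns n m ] (⟦ inH f' ⟧ * κ (f' v) v)
        ≡⟨ ∑-cong (allFuns n m) (λ f' → ⟦∧⟧-* (agreeOff v f f') _ _) ⟩
      ∑[ f' ∈ allFuns n m ] (⟦ agreeOff v f f' ⟧ * (⟦ adj H (f v) (f' v) ⟧ * κ (f' v) v))
        ≡⟨ ∑-allFuns-agreeOff v f (λ b → ⟦ adj H (f v) b ⟧ * κ b v) ⟩
      ∑[ b ∈ allFin m ] (⟦ adj H (f v) b ⟧ * κ b v) ∎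

    G-neighbours : ∑[ f' ∈ allFuns n m ] ∑[ v' ∈ allFin n ] (⟦ inG f' v' ⟧ * κ (f' v') v')
                     ≡ ∑[ v' ∈ allFin n ] (⟦ adj G v v' ⟧ * κ (f v') v')
    G-neighbours = begin
      ∑[ f' ∈ allFuns n m ] ∑[ v' ∈ allFin n ] (⟦ inG f' v' ⟧ * κ (f' v') v')
        ≡⟨ ∑-cong (allFuns n m) (λ f' → trans (∑-cong (allFin n) (λ v' → ⟦∧⟧-* (funEq f f') (adj G v v') (κ (f' v') v')))
                                             (∑-*ˡ (allFin n) ⟦ funEq f f' ⟧ _)) ⟩
      ∑[ f' ∈ allFuns n m ] (⟦ funEq f f' ⟧ * ∑[ v' ∈ allFin n ] (⟦ adj G v v' ⟧ * κ (f' v') v'))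
        ≡⟨ ∑-allFuns-funEq f _ (λ g≗g' → ∑-cong (allFin n) (λ v' → cong (λ b → ⟦ adj G v v' ⟧ * κ b v') (g≗g' v'))) ⟩
      ∑[ v' ∈ allFin n ] (⟦ adj G v v' ⟧ * κ (f v') v') ∎

  private
    dG : Fin n → ℕ
    dG = degG G
    dH : Fin m → ℕ
    dH = degG H
    dW : WVertex n m → ℕ
    dW = deg (wreathVertices n m) (wreathAdj G H)
    module G′ = GraphInvariants (allFin n) (adj G) (SimpleGraph.sym G) (irrefl G)
    module H′ = GraphInvariants (allFin m) (adj H) (SimpleGraph.sym H) (irrefl H)
    module W′ = GraphInvariants (wreathVertices n m) (wreathAdj G H) wreathAdj-sym wreathAdj-irrefl

  deg-wreath : ∀ f v → dW (f , v) ≡ dH (f v) + dG v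
  deg-wreath f v = begin
    deg (wreathVertices n m) (wreathAdj G H) (f , v)          ≡⟨ W′.deg≡∑ (f , v) ⟩
    ∑[ y ∈ wreathVertices n m ] ⟦ wreathAdj G H (f , v) y ⟧
      ≡⟨ ∑-cong (wreathVertices n m) (λ y → sym (*-identityʳ _)) ⟩
    ∑[ y ∈ wreathVertices n m ] (⟦ wreathAdj G H (f , v) y ⟧ * 1) ≡⟨ ∑-neighbours f v (λ _ _ → 1) ⟩
    ∑[ b ∈ allFin m ] (⟦ adj H (f v) b ⟧ * 1) + ∑[ v' ∈ allFin n ] (⟦ adj G v v' ⟧ * 1)
      ≡⟨ cong₂ _+_ (degree H (f v)) (degree G v) ⟩
    dH (f v) + dG v                                            ∎
    where
    degree : ∀ {k} (K : SimpleGraph k) u → ∑[ w ∈ allFin k ] (⟦ adj K u w ⟧ * 1) ≡ degG K u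
    degree {k} K u = trans (∑-cong (allFin k) (λ w → *-identityʳ _)) (sym (length-filter (allFin k) (adj K u)))

  M₁-wreath : M₁≀ G H ≡ m ^ (n ∸ 1) * (m * M₁G G + n * M₁G H + 8 * |E| G * |E| H)
  M₁-wreath = begin
    M₁≀ G H                                                             ≡⟨ ∑-wreathVertices _ ⟩
    ∑[ f ∈ allFuns n m ] ∑[ v ∈ allFin n ] (dW (f , v) * dW (f , v))
      ≡⟨ ∑-cong (allFuns n m) (λ f → ∑-cong (allFin n) (λ v → cong₂ _*_ (deg-wreath f v) (deg-wreath f v))) ⟩
    ∑[ f ∈ allFuns n m ] ∑[ v ∈ allFin n ] ((dH (f v) + dG v) * (dH (f v) + dG v))
      ≡⟨ ∑-allFuns-evalAt (λ a v → (dH a + dG v) * (dH a + dG v)) ⟩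
    m ^ (n ∸ 1) * ∑[ v ∈ allFin n ] ∑[ a ∈ allFin m ] ((dH a + dG v) * (dH a + dG v))
      ≡⟨ cong (m ^ (n ∸ 1) *_) (∑∑-square (allFin n) (allFin m) dH dG) ⟩
    m ^ (n ∸ 1) * (length (allFin n) * M₁G H + 2 * ∑ (allFin m) dH * ∑ (allFin n) dG + length (allFin m) * M₁G G)
      ≡⟨ cong (m ^ (n ∸ 1) *_) (cong₂ _+_ (cong₂ _+_ (cong (_* M₁G H) (length-allFin n))
                                                   (cong₂ (λ s t → 2 * s * t) H′.∑-deg G′.∑-deg))
                                        (cong (_* M₁G G) (length-allFin m))) ⟩
    m ^ (n ∸ 1) * (n * M₁G H + 2 * (2 * |E| H) * (2 * |E| G) + m * M₁G G)
      ≡⟨ cong (m ^ (n ∸ 1) *_) (solve 6 (λ n m a b e f → n :* b :+ con 2 :* (con 2 :* f) :* (con 2 :* e) :+ m :* a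
                                                        := m :* a :+ n :* b :+ con 8 :* e :* f)
                                         refl n m (M₁G G) (M₁G H) (|E| G) (|E| H)) ⟩
    m ^ (n ∸ 1) * (m * M₁G G + n * M₁G H + 8 * |E| G * |E| H)           ∎
    where
    length-allFin : ∀ k → length (allFin k) ≡ k
    length-allFin k = length-tabulate (λ i → i)

  ∑-neighbour-degrees : ∀ f v →
    ∑[ y ∈ wreathVertices n m ] (⟦ wreathAdj G H (f , v) y ⟧ * (dW (f , v) * dW y))
      ≡ (dH (f v) + dG v) * (∑[ b ∈ allFin m ] (⟦ adj H (f v) b ⟧ * (dH b + dG v))
                             + ∑[ v' ∈ allFin n ] (⟦ adj G v v' ⟧ * (dH (f v') + dG v')))
  ∑-neighbour-degrees f v = begin
    ∑[ y ∈ wreathVertices n m ] (⟦ wreathAdj G H (f , v) y ⟧ * (dW (f , v) * dW y))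
      ≡⟨ ∑-cong (wreathVertices n m) (λ y → x∙yz≈y∙xz ⟦ wreathAdj G H (f , v) y ⟧ (dW (f , v)) (dW y)) ⟩
    ∑[ y ∈ wreathVertices n m ] (dW (f , v) * (⟦ wreathAdj G H (f , v) y ⟧ * dW y))
      ≡⟨ ∑-*ˡ (wreathVertices n m) (dW (f , v)) _ ⟩
    dW (f , v) * ∑[ y ∈ wreathVertices n m ] (⟦ wreathAdj G H (f , v) y ⟧ * dW y)
      ≡⟨ cong₂ _*_ (deg-wreath f v)
           (∑-cong (wreathVertices n m) (λ y → cong (⟦ wreathAdj G H (f , v) y ⟧ *_) (deg-wreath (proj₁ y) (proj₂ y)))) ⟩
    (dH (f v) + dG v)
      * ∑[ y ∈ wreathVertices n m ] (⟦ wreathAdj G H (f , v) y ⟧ * (dH (proj₁ y (proj₂ y)) + dG (proj₂ y)))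
      ≡⟨ cong ((dH (f v) + dG v) *_) (∑-neighbours f v (λ b v' → dH b + dG v')) ⟩
    (dH (f v) + dG v) * (∑[ b ∈ allFin m ] (⟦ adj H (f v) b ⟧ * (dH b + dG v))
                         + ∑[ v' ∈ allFin n ] (⟦ adj G v v' ⟧ * (dH (f v') + dG v'))) ∎

  H-edge-contribution :
    ∑[ f ∈ allFuns n m ] ∑[ v ∈ allFin n ] ((dH (f v) + dG v) * ∑[ b ∈ allFin m ] (⟦ adj H (f v) b ⟧ * (dH b + dG v)))
      ≡ m ^ (n ∸ 1) * (2 * |E| H * M₁G G + 2 * M₁G H * (2 * |E| G) + 2 * M₂G H * (n * 1))
  H-edge-contribution = begin
    ∑[ f ∈ allFuns n m ] ∑[ v ∈ allFin n ] ((dH (f v) + dG v) * ∑[ b ∈ allFin m ] (⟦ adj H (f v) b ⟧ * (dH b + dG v)))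
      ≡⟨ ∑-allFuns-evalAt (λ a v → (dH a + dG v) * ∑[ b ∈ allFin m ] (⟦ adj H a b ⟧ * (dH b + dG v))) ⟩
    m ^ (n ∸ 1) * ∑[ v ∈ allFin n ] ∑[ a ∈ allFin m ] ((dH a + dG v) * ∑[ b ∈ allFin m ] (⟦ adj H a b ⟧ * (dH b + dG v)))
      ≡⟨ cong (m ^ (n ∸ 1) *_) (∑-cong (allFin n) (λ v → trans (H-shifted (dG v)) (regroup (dG v)))) ⟩
    m ^ (n ∸ 1) * ∑[ v ∈ allFin n ] (2 * |E| H * (dG v * dG v) + 2 * M₁G H * dG v + 2 * M₂G H * 1)
      ≡⟨ cong (m ^ (n ∸ 1) *_) (∑-linear₃ (allFin n) (2 * |E| H) (2 * M₁G H) (2 * M₂G H) (λ v → dG v * dG v) dG (λ _ → 1)) ⟩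
    m ^ (n ∸ 1) * (2 * |E| H * M₁G G + 2 * M₁G H * ∑ (allFin n) dG + 2 * M₂G H * ∑[ v ∈ allFin n ] 1)
      ≡⟨ cong₂ (λ s t → m ^ (n ∸ 1) * (2 * |E| H * M₁G G + 2 * M₁G H * s + 2 * M₂G H * t)) G′.∑-deg (∑-allFin-const n 1) ⟩
    m ^ (n ∸ 1) * (2 * |E| H * M₁G G + 2 * M₁G H * (2 * |E| G) + 2 * M₂G H * (n * 1)) ∎
    where
    H-shifted : ∀ c → ∑[ a ∈ allFin m ] ((dH a + c) * ∑[ b ∈ allFin m ] (⟦ adj H a b ⟧ * (dH b + c)))
                        ≡ 2 * (c * c * |E| H + c * M₁G H + 1 * M₂G H)
    H-shifted c = begin
      ∑[ a ∈ allFin m ] ((dH a + c) * ∑[ b ∈ allFin m ] (⟦ adj H a b ⟧ * (dH b + c)))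
        ≡⟨ ∑-cong (allFin m) (λ a → trans (sym (∑-*ˡ (allFin m) (dH a + c) _)) (∑-cong (allFin m) (λ b →
             solve 4 (λ i x y c → (x :+ c) :* (i :* (y :+ c)) := i :* (c :* c :+ c :* (x :+ y) :+ con 1 :* (x :* y)))
                     refl ⟦ adj H a b ⟧ (dH a) (dH b) c))) ⟩
      ∑[ a ∈ allFin m ] ∑[ b ∈ allFin m ] (⟦ adj H a b ⟧ * (c * c + c * (dH a + dH b) + 1 * (dH a * dH b)))
        ≡⟨ H′.∑-adj-quadratic (c * c) c 1 ⟩
      2 * (c * c * |E| H + c * M₁G H + 1 * M₂G H) ∎
    regroup : ∀ c → 2 * (c * c * |E| H + c * M₁G H + 1 * M₂G H) ≡ 2 * |E| H * (c * c) + 2 * M₁G H * c + 2 * M₂G H * 1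
    regroup c = solve 4 (λ c e a b → con 2 :* (c :* c :* e :+ c :* a :+ con 1 :* b)
                                     := con 2 :* e :* (c :* c) :+ con 2 :* a :* c :+ con 2 :* b :* con 1)
                        refl c (|E| H) (M₁G H) (M₂G H)

  G-edge-contribution :
    ∑[ f ∈ allFuns n m ] ∑[ v ∈ allFin n ] ((dH (f v) + dG v) * ∑[ v' ∈ allFin n ] (⟦ adj G v v' ⟧ * (dH (f v') + dG v')))
      ≡ 2 * (m ^ (n ∸ 2) * (2 * |E| H * (2 * |E| H)) * |E| G + m ^ (n ∸ 1) * (2 * |E| H) * M₁G G + m ^ n * M₂G G)
  G-edge-contribution = begin
    ∑[ f ∈ allFuns n m ] ∑[ v ∈ allFin n ] ((dH (f v) + dG v) * ∑[ v' ∈ allFin n ] (⟦ adj G v v' ⟧ * (dH (f v') + dG v')))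
      ≡⟨ ∑-cong (allFuns n m) (λ f → ∑-cong (allFin n) (λ v → trans (sym (∑-*ˡ (allFin n) (dH (f v) + dG v) _))
           (∑-cong (allFin n) (λ v' → x∙yz≈y∙xz (dH (f v) + dG v) ⟦ adj G v v' ⟧ (dH (f v') + dG v'))))) ⟩
    ∑[ f ∈ allFuns n m ] ∑[ v ∈ allFin n ] ∑[ v' ∈ allFin n ] (⟦ adj G v v' ⟧ * ((dH (f v) + dG v) * (dH (f v') + dG v')))
      ≡⟨ trans (∑-comm (allFuns n m) (allFin n) _) (∑-cong (allFin n) (λ v → ∑-comm (allFuns n m) (allFin n) _)) ⟩
    ∑[ v ∈ allFin n ] ∑[ v' ∈ allFin n ] ∑[ f ∈ allFuns n m ] (⟦ adj G v v' ⟧ * ((dH (f v) + dG v) * (dH (f v') + dG v')))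
      ≡⟨ ∑-cong (allFin n) (λ v → ∑-cong (allFin n) (λ v' → trans (∑-*ˡ (allFuns n m) ⟦ adj G v v' ⟧ _) (adjacent v v'))) ⟩
    ∑[ v ∈ allFin n ] ∑[ v' ∈ allFin n ] (⟦ adj G v v' ⟧ * (α + β * (dG v + dG v') + γ * (dG v * dG v')))
      ≡⟨ G′.∑-adj-quadratic α β γ ⟩
    2 * (m ^ (n ∸ 2) * (S * S) * |E| G + m ^ (n ∸ 1) * S * M₁G G + γ * M₂G G)
      ≡⟨ cong (λ s → 2 * (m ^ (n ∸ 2) * (s * s) * |E| G + m ^ (n ∸ 1) * s * M₁G G + γ * M₂G G)) H′.∑-deg ⟩
    2 * (m ^ (n ∸ 2) * (2 * |E| H * (2 * |E| H)) * |E| G + m ^ (n ∸ 1) * (2 * |E| H) * M₁G G + m ^ n * M₂G G) ∎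
    where
    S α β γ : ℕ
    S = ∑ (allFin m) dH
    α = m ^ (n ∸ 2) * (S * S)
    β = m ^ (n ∸ 1) * S
    γ = m ^ n
    adjacent : ∀ v v' → ⟦ adj G v v' ⟧ * ∑[ f ∈ allFuns n m ] ((dH (f v) + dG v) * (dH (f v') + dG v'))
                          ≡ ⟦ adj G v v' ⟧ * (α + β * (dG v + dG v') + γ * (dG v * dG v'))
    adjacent v v' with v ≟ v'
    ... | yes refl rewrite irrefl G v = refl
    ... | no v≢v'  = cong (⟦ adj G v v' ⟧ *_) (∑-allFuns-affineProduct v≢v' dH (dG v) (dG v'))

  M₂-wreath : M₂≀ G H ≡ 3 * m ^ (n ∸ 1) * |E| H * M₁G G
                      + 2 * |E| G * m ^ (n ∸ 1) * M₁G H
                      + m ^ n * M₂G G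
                      + n * m ^ (n ∸ 1) * M₂G H
                      + 4 * m ^ (n ∸ 2) * |E| G * |E| H * |E| H
  M₂-wreath = *-cancelˡ-≡ _ _ 2 (begin
    2 * M₂≀ G H
      ≡⟨ W′.∑-edges (λ x y → dW x * dW y) (λ x y → *-comm (dW x) (dW y)) ⟩
    ∑[ x ∈ wreathVertices n m ] ∑[ y ∈ wreathVertices n m ] (⟦ wreathAdj G H x y ⟧ * (dW x * dW y))
      ≡⟨ ∑-wreathVertices _ ⟩
    ∑[ f ∈ allFuns n m ] ∑[ v ∈ allFin n ] ∑[ y ∈ wreathVertices n m ] (⟦ wreathAdj G H (f , v) y ⟧ * (dW (f , v) * dW y))
      ≡⟨ ∑-cong (allFuns n m) (λ f → ∑-cong (allFin n) (λ v → ∑-neighbour-degrees f v)) ⟩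
    ∑[ f ∈ allFuns n m ] ∑[ v ∈ allFin n ] (E f v * (A f v + B f v))
      ≡⟨ trans (∑-cong (allFuns n m) (λ f → trans (∑-cong (allFin n) (λ v → *-distribˡ-+ (E f v) (A f v) (B f v)))
                                                   (∑-+ (allFin n) _ _)))
               (∑-+ (allFuns n m) _ _) ⟩
    ∑[ f ∈ allFuns n m ] ∑[ v ∈ allFin n ] (E f v * A f v) + ∑[ f ∈ allFuns n m ] ∑[ v ∈ allFin n ] (E f v * B f v)
      ≡⟨ cong₂ _+_ H-edge-contribution G-edge-contribution ⟩
    m ^ (n ∸ 1) * (2 * |E| H * M₁G G + 2 * M₁G H * (2 * |E| G) + 2 * M₂G H * (n * 1))
      + 2 * (m ^ (n ∸ 2) * (2 * |E| H * (2 * |E| H)) * |E| G + m ^ (n ∸ 1) * (2 * |E| H) * M₁G G + m ^ n * M₂G G)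
      ≡⟨ solve 10 (λ n p q r a b c g d e →
             q :* (con 2 :* e :* a :+ con 2 :* b :* (con 2 :* d) :+ con 2 :* c :* (n :* con 1))
               :+ con 2 :* (r :* (con 2 :* e :* (con 2 :* e)) :* d :+ q :* (con 2 :* e) :* a :+ p :* g)
             := con 2 :* (con 3 :* q :* e :* a :+ con 2 :* d :* q :* b :+ p :* g :+ n :* q :* c :+ con 4 :* r :* d :* e :* e))
           refl n (m ^ n) (m ^ (n ∸ 1)) (m ^ (n ∸ 2)) (M₁G G) (M₁G H) (M₂G H) (M₂G G) (|E| G) (|E| H) ⟩
    2 * (3 * m ^ (n ∸ 1) * |E| H * M₁G G + 2 * |E| G * m ^ (n ∸ 1) * M₁G H + m ^ n * M₂G G
         + n * m ^ (n ∸ 1) * M₂G H + 4 * m ^ (n ∸ 2) * |E| G * |E| H * |E| H) ∎)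
    where
    E : (Fin n → Fin m) → Fin n → ℕ
    E f v = dH (f v) + dG v
    A B : (Fin n → Fin m) → Fin n → ℕ
    A f v = ∑[ b ∈ allFin m ] (⟦ adj H (f v) b ⟧ * (dH b + dG v))
    B f v = ∑[ v' ∈ allFin n ] (⟦ adj G v v' ⟧ * (dH (f v') + dG v'))

theorem3p1 : ∀ {n m} (G : SimpleGraph n) (H : SimpleGraph m) →
    Connected G → Connected H →
    (M₁≀ G H ≡ m ^ (n ∸ 1) * (m * M₁G G + n * M₁G H + 8 * |E| G * |E| H))
    × (M₂≀ G H ≡ 3 * m ^ (n ∸ 1) * |E| H * M₁G G
                 + 2 * |E| G * m ^ (n ∸ 1) * M₁G H
                 + m ^ n * M₂G G
                 + n * m ^ (n ∸ 1) * M₂G H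
                 + 4 * m ^ (n ∸ 2) * |E| G * |E| H * |E| H)
theorem3p1 G H _ _ = Wreath.M₁-wreath G H , Wreath.M₂-wreath G H
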